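{- Let $\phi(R)=\forall\bar x(R\bar x\rightarrow\theta(R,\bar x))$ be a myopic sentence. Then there is an Inclusion Logic formula $\phi^+(\bar x)$ such that for all models $M$ and teams $X$ on $M$ (with domain containing the variables of $\bar x$), $$M\models_X\phi^+(\bar x)\iff (M,X(\bar x))\models\phi(R).$$
   Context: A sentence $\phi(R)$ is myopic if it has the form $\forall\bar x(R\bar x\rightarrow\theta(R,\bar x))$ where $\theta$ is a first-order formula in which $R$ occurs only positively (and $\mathrm{ar}(R)=|\bar x|$). A team $X$ over $M$ is a set of assignments into $\mathrm{dom}(M)$; $X(\bar x)=\{\bar x\langle s\rangle:s\in X\}$, and $(M,P)$ interprets $R$ by $P$. Inclusion Logic formulas are first-order formulas in negation normal form plus inclusion atoms $\bar t_1\subseteq\bar t_2$, with lax team semantics: literals hold in $X$ iff they hold under every $s\in X$; $M\models_X\bar t_1\subseteq\bar t_2$ iff $X(\bar t_1)\subseteq X(\bar t_2)$; $M\models_X\phi\vee\psi$ iff $X=Y\cup Z$ with $M\models_Y\phi$, $M\models_Z\psi$; $\wedge$ is conjunction; $M\models_X\exists v\phi$ iff $M\models_{X[H/v]}\phi$ for some $H:X\to\mathcal P(\mathrm{dom}(M))\setminus\{\emptyset\}$, where $X[H/v]=\{s[m/v]:s\in X,m\in H(s)\}$; $M\models_X\forall v\phi$ iff $M\models_{X[M/v]}\phi$, where $X[M/v]=\{s[m/v]:s\in X,m\in\mathrm{dom}(M)\}$. -}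

module Defs where

open import Level using (0ℓ)
open import Data.Nat using (ℕ; _≟_)
open import Data.Fin using (Fin)
open import Data.Vec using (Vec; []; _∷_; lookup; map)
open import Data.Vec.Membership.Propositional using (_∈_)
open import Data.Product using (Σ; ∃; _×_; _,_)
open import Data.Sum using (_⊎_)
open import Data.Empty using (⊥)
open import Data.Bool using (if_then_else_)
open import Relation.Nullary using (¬_)
open import Relation.Nullary.Decidable using (⌊_⌋)
open import Relation.Binary.PropositionalEquality using (_≡_)
open import Function.Bundles using (_⇔_)

Var : Set
Var = ℕ

-- A (first-order) vocabulary: relation and function symbols with arities
-- (constants are 0-ary function symbols).
record Vocabulary : Set₁ where
  field
    RelSym : Set
    rar    : RelSym → ℕ
    FunSym : Set
    far    : FunSym → ℕ
open Vocabulary public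

data Term (Σ' : Vocabulary) : Set where
  var : Var → Term Σ'
  app : (f : FunSym Σ') → Vec (Term Σ') (far Σ' f) → Term Σ'

record Model (Σ' : Vocabulary) : Set₁ where
  field
    Carrier : Set
    point   : Carrier
    relI    : (r : RelSym Σ') → Vec Carrier (rar Σ' r) → Set
    funI    : (f : FunSym Σ') → Vec Carrier (far Σ' f) → Carrier
open Model public

Assign : Set → Set
Assign A = Var → A

_[_/_] : {A : Set} → Assign A → A → Var → Assign A
(s [ m / v ]) i = if ⌊ i ≟ v ⌋ then m else s i

_≗A_ : {A : Set} → Assign A → Assign A → Set
s ≗A t = ∀ i → s i ≡ t i

mutual
  evalT : {Σ' : Vocabulary} (M : Model Σ') → Assign (Carrier M) → Term Σ' → Carrier M
  evalT M s (var x) = s x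
  evalT M s (app f ts) = funI M f (evalTs M s ts)

  evalTs : {Σ' : Vocabulary} (M : Model Σ') → Assign (Carrier M) → {n : ℕ} → Vec (Term Σ') n → Vec (Carrier M) n
  evalTs M s [] = []
  evalTs M s (t ∷ ts) = evalT M s t ∷ evalTs M s ts

mutual
  OccT : {Σ' : Vocabulary} → Var → Term Σ' → Set
  OccT v (var x) = v ≡ x
  OccT v (app f ts) = OccTs v ts

  OccTs : {Σ' : Vocabulary} → Var → {n : ℕ} → Vec (Term Σ') n → Set
  OccTs v [] = ⊥
  OccTs v (t ∷ ts) = OccT v t ⊎ OccTs v ts

-- First-order formulas in negation normal form over Σ' ∪ {R}, where R
-- (arity k) occurs only positively.

data PosFormula (Σ' : Vocabulary) (k : ℕ) : Set where
  eq   : Term Σ' → Term Σ' → PosFormula Σ' k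
  neq  : Term Σ' → Term Σ' → PosFormula Σ' k
  rel  : (r : RelSym Σ') → Vec (Term Σ') (rar Σ' r) → PosFormula Σ' k
  nrel : (r : RelSym Σ') → Vec (Term Σ') (rar Σ' r) → PosFormula Σ' k
  Ratom : Vec (Term Σ') k → PosFormula Σ' k
  _∧'_ : PosFormula Σ' k → PosFormula Σ' k → PosFormula Σ' k
  _∨'_ : PosFormula Σ' k → PosFormula Σ' k → PosFormula Σ' k
  ∃' : Var → PosFormula Σ' k → PosFormula Σ' k
  ∀' : Var → PosFormula Σ' k → PosFormula Σ' k

FreeP : {Σ' : Vocabulary} {k : ℕ} → Var → PosFormula Σ' k → Set
FreeP v (eq t u) = OccT v t ⊎ OccT v u
FreeP v (neq t u) = OccT v t ⊎ OccT v u
FreeP v (rel r ts) = OccTs v ts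
FreeP v (nrel r ts) = OccTs v ts
FreeP v (Ratom ts) = OccTs v ts
FreeP v (φ ∧' ψ) = FreeP v φ ⊎ FreeP v ψ
FreeP v (φ ∨' ψ) = FreeP v φ ⊎ FreeP v ψ
FreeP v (∃' u φ) = ¬ (v ≡ u) × FreeP v φ
FreeP v (∀' u φ) = ¬ (v ≡ u) × FreeP v φ

satP : {Σ' : Vocabulary} {k : ℕ} (M : Model Σ') (P : Vec (Carrier M) k → Set)
     → Assign (Carrier M) → PosFormula Σ' k → Set
satP M P s (eq t u) = evalT M s t ≡ evalT M s u
satP M P s (neq t u) = ¬ (evalT M s t ≡ evalT M s u)
satP M P s (rel r ts) = relI M r (evalTs M s ts)
satP M P s (nrel r ts) = ¬ relI M r (evalTs M s ts)
satP M P s (Ratom ts) = P (evalTs M s ts)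
satP M P s (φ ∧' ψ) = satP M P s φ × satP M P s ψ
satP M P s (φ ∨' ψ) = satP M P s φ ⊎ satP M P s ψ
satP M P s (∃' v φ) = Σ (Carrier M) (λ m → satP M P (s [ m / v ]) φ)
satP M P s (∀' v φ) = (m : Carrier M) → satP M P (s [ m / v ]) φ

_[_//_] : {A : Set} {k : ℕ} → Assign A → Vec A k → Vec Var k → Assign A
s [ [] // [] ] = s
s [ a ∷ as // x ∷ xs ] = (s [ as // xs ]) [ a / x ]

-- A myopic sentence ∀x̄ (R x̄ → θ(R, x̄)): x̄ a tuple of k distinct variables,
-- θ an R-positive first-order formula whose free variables are among x̄.
record Myopic (Σ' : Vocabulary) (k : ℕ) : Set where
  field
    xs       : Vec Var k
    θ        : PosFormula Σ' k
    distinct : (i j : Fin k) → lookup xs i ≡ lookup xs j → i ≡ j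
    closed   : (v : Var) → FreeP v θ → v ∈ xs
open Myopic public

_,_⊨M_ : {Σ' : Vocabulary} {k : ℕ} (M : Model Σ') (P : Vec (Carrier M) k → Set)
       → Myopic Σ' k → Set
M , P ⊨M φ = (s : Assign (Carrier M)) (as : Vec (Carrier M) _)
           → P as → satP M P (s [ as // xs φ ]) (θ φ)

-- Inclusion logic (negation normal form + inclusion atoms), lax team semantics.

data IncFormula (Σ' : Vocabulary) : Set where
  eq   : Term Σ' → Term Σ' → IncFormula Σ'
  neq  : Term Σ' → Term Σ' → IncFormula Σ'
  rel  : (r : RelSym Σ') → Vec (Term Σ') (rar Σ' r) → IncFormula Σ'
  nrel : (r : RelSym Σ') → Vec (Term Σ') (rar Σ' r) → IncFormula Σ'
  inc  : {n : ℕ} → Vec (Term Σ') n → Vec (Term Σ') n → IncFormula Σ'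
  _∧'_ : IncFormula Σ' → IncFormula Σ' → IncFormula Σ'
  _∨'_ : IncFormula Σ' → IncFormula Σ' → IncFormula Σ'
  ∃' : Var → IncFormula Σ' → IncFormula Σ'
  ∀' : Var → IncFormula Σ' → IncFormula Σ'

FreeI : {Σ' : Vocabulary} → Var → IncFormula Σ' → Set
FreeI v (eq t u) = OccT v t ⊎ OccT v u
FreeI v (neq t u) = OccT v t ⊎ OccT v u
FreeI v (rel r ts) = OccTs v ts
FreeI v (nrel r ts) = OccTs v ts
FreeI v (inc ts us) = OccTs v ts ⊎ OccTs v us
FreeI v (φ ∧' ψ) = FreeI v φ ⊎ FreeI v ψ
FreeI v (φ ∨' ψ) = FreeI v φ ⊎ FreeI v ψ
FreeI v (∃' u φ) = ¬ (v ≡ u) × FreeI v φ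
FreeI v (∀' u φ) = ¬ (v ≡ u) × FreeI v φ

Team : Set → Set₁
Team A = Assign A → Set

_⊨[_]_ : {Σ' : Vocabulary} (M : Model Σ') → Team (Carrier M) → IncFormula Σ' → Set₁
M ⊨[ X ] eq t u = ∀ s → X s → Level.Lift _ (evalT M s t ≡ evalT M s u)
M ⊨[ X ] neq t u = ∀ s → X s → Level.Lift _ (¬ (evalT M s t ≡ evalT M s u))
M ⊨[ X ] rel r ts = ∀ s → X s → Level.Lift _ (relI M r (evalTs M s ts))
M ⊨[ X ] nrel r ts = ∀ s → X s → Level.Lift _ (¬ relI M r (evalTs M s ts))
M ⊨[ X ] inc ts us = ∀ s → X s → Level.Lift _
  (∃ λ s' → X s' × evalTs M s ts ≡ evalTs M s' us)
M ⊨[ X ] (φ ∧' ψ) = (M ⊨[ X ] φ) × (M ⊨[ X ] ψ)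
M ⊨[ X ] (φ ∨' ψ) = Σ (Team (Carrier M)) λ Y → Σ (Team (Carrier M)) λ Z →
  ((∀ s → X s → Y s ⊎ Z s) × (∀ s → Y s → X s) × (∀ s → Z s → X s))
  × (M ⊨[ Y ] φ) × (M ⊨[ Z ] ψ)
M ⊨[ X ] ∃' v φ =
  Σ ((s : Assign (Carrier M)) → X s → Carrier M → Set) λ H →
    ((s : Assign (Carrier M)) (p : X s) → ∃ λ m → H s p m)
    × (M ⊨[ (λ t → ∃ λ s → Σ (X s) λ p → ∃ λ m → H s p m × (t ≗A (s [ m / v ]))) ] φ)
M ⊨[ X ] ∀' v φ =
  M ⊨[ (λ t → ∃ λ s → X s × ∃ λ m → t ≗A (s [ m / v ])) ] φ

teamRel : {A : Set} {k : ℕ} → Team A → Vec Var k → Vec A k → Set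
teamRel X xs as = ∃ λ s → X s × map s xs ≡ as

-- Let w̄ be fresh distinct variables and θ′ the result of replacing every atom
-- R t̄ of θ by t̄ ⊆ w̄; then φ⁺ = ∃w̄ (w̄ ⊆ x̄ ∧ θ′).  In a team whose values of w̄
-- all lie in X(x̄), which the first conjunct guarantees, the atom t̄ ⊆ w̄ forces
-- the values of t̄ into X(x̄), so θ′ entails θ at each assignment.  Conversely,
-- if φ holds, take the team of all extensions of X by values of w̄ in X(x̄).
-- It satisfies w̄ ⊆ x̄, and it is closed under resetting w̄ to any tuple of
-- X(x̄); that closure supplies a witness for each translated atom, and it is
-- inherited by the subteams and supplements chosen along θ because w̄ is fresh.
-- Since R occurs only positively, no atom ¬R t̄ needs a translation.
module Submission where

open import Defs
open import Level using (lift; lower)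
open import Data.Nat using (ℕ; zero; suc; _≤_; _<_; _≟_; _⊔_; s≤s)
open import Data.Nat.Properties
  using (≤-refl; ≤-reflexive; <⇒≤; <⇒≢; <⇒≱; <-≤-trans; m≤m⊔n; m≤n⊔m)
open import Data.Vec using (Vec; []; _∷_; map)
open import Data.Vec.Properties using (map-cong)
open import Data.Vec.Relation.Unary.Any using (here; there)
open import Data.Vec.Relation.Unary.All as All using (All; []; _∷_)
open import Data.Vec.Relation.Unary.Unique.Propositional using (Unique; []; _∷_)
open import Data.Vec.Membership.Propositional using (_∈_; _∉_)
open import Data.Vec.Membership.DecPropositional _≟_ using (_∈?_)
open import Data.Product using (Σ; ∃; _×_; _,_; proj₁; proj₂)
open import Data.Sum as Sum using (_⊎_; inj₁; inj₂; [_,_]′)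
open import Data.Empty using (⊥-elim)
open import Relation.Nullary using (¬_; yes; no)
open import Relation.Binary.PropositionalEquality
  using (_≡_; refl; sym; trans; cong; cong₂; subst; module ≡-Reasoning)
open import Function.Bundles using (_⇔_; mk⇔)

module _ {A : Set} where

  ≗A-sym : {s t : Assign A} → s ≗A t → t ≗A s
  ≗A-sym e i = sym (e i)

  ≗A-trans : {s t r : Assign A} → s ≗A t → t ≗A r → s ≗A r
  ≗A-trans e f i = trans (e i) (f i)

  update-≡ : ∀ (s : Assign A) m {v u} → v ≡ u → (s [ m / u ]) v ≡ m
  update-≡ s m {v} {u} v≡u with v ≟ u
  ... | yes _ = refl
  ... | no v≢u = ⊥-elim (v≢u v≡u)

  update-≢ : ∀ (s : Assign A) m {v u} → ¬ v ≡ u → (s [ m / u ]) v ≡ s v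
  update-≢ s m {v} {u} v≢u with v ≟ u
  ... | yes v≡u = ⊥-elim (v≢u v≡u)
  ... | no _ = refl

  update-agree : ∀ (r r' : Assign A) m u v → (¬ v ≡ u → r v ≡ r' v)
               → (r [ m / u ]) v ≡ (r' [ m / u ]) v
  update-agree r r' m u v h with v ≟ u
  ... | yes _ = refl
  ... | no v≢u = h v≢u

  update-cong : ∀ {r r' : Assign A} m u → r ≗A r' → (r [ m / u ]) ≗A (r' [ m / u ])
  update-cong {r} {r'} m u e v = update-agree r r' m u v (λ _ → e v)

  updates-agree : ∀ {n} (r r' : Assign A) (bs : Vec A n) (ws : Vec Var n) v
                → v ∈ ws ⊎ r v ≡ r' v → (r [ bs // ws ]) v ≡ (r' [ bs // ws ]) v
  updates-agree r r' [] [] v (inj₂ e) = e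
  updates-agree r r' (b ∷ bs) (w ∷ ws) v h =
    update-agree (r [ bs // ws ]) (r' [ bs // ws ]) b w v
      (λ v≢w → updates-agree r r' bs ws v (shift v≢w h))
    where
      shift : ¬ v ≡ w → v ∈ w ∷ ws ⊎ _ → v ∈ ws ⊎ _
      shift v≢w (inj₁ (here v≡w)) = ⊥-elim (v≢w v≡w)
      shift _ (inj₁ (there v∈ws)) = inj₁ v∈ws
      shift _ (inj₂ e) = inj₂ e

  updates-cong : ∀ {n} {r r' : Assign A} (bs : Vec A n) (ws : Vec Var n)
               → r ≗A r' → (r [ bs // ws ]) ≗A (r' [ bs // ws ])
  updates-cong {r = r} {r'} bs ws e v = updates-agree r r' bs ws v (inj₂ (e v))

  updates-∉ : ∀ {n} (s : Assign A) (as : Vec A n) (ws : Vec Var n) {v}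
            → v ∉ ws → (s [ as // ws ]) v ≡ s v
  updates-∉ s [] [] v∉ws = refl
  updates-∉ s (a ∷ as) (w ∷ ws) v∉ws =
    trans (update-≢ (s [ as // ws ]) a (λ v≡w → v∉ws (here v≡w)))
          (updates-∉ s as ws (λ v∈ws → v∉ws (there v∈ws)))

  updates-overwrite : ∀ {n} (s : Assign A) (as bs : Vec A n) (ws : Vec Var n)
                    → ((s [ as // ws ]) [ bs // ws ]) ≗A (s [ bs // ws ])
  updates-overwrite s as bs ws v with v ∈? ws
  ... | yes v∈ws = updates-agree (s [ as // ws ]) s bs ws v (inj₁ v∈ws)
  ... | no v∉ws = updates-agree (s [ as // ws ]) s bs ws v (inj₂ (updates-∉ s as ws v∉ws))

  updates-comm : ∀ {n} (s : Assign A) m {v} (as : Vec A n) (ws : Vec Var n) → v ∉ ws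
               → ((s [ m / v ]) [ as // ws ]) ≗A ((s [ as // ws ]) [ m / v ])
  updates-comm s m {v} as ws v∉ws u with u ≟ v
  ... | yes refl = trans (updates-∉ (s [ m / v ]) as ws v∉ws) (update-≡ s m refl)
  ... | no u≢v = updates-agree (s [ m / v ]) s as ws u (inj₂ (update-≢ s m u≢v))

  map-agree : ∀ {n} {r r' : Assign A} (vs : Vec Var n)
            → (∀ v → v ∈ vs → r v ≡ r' v) → map r vs ≡ map r' vs
  map-agree [] f = refl
  map-agree (v ∷ vs) f = cong₂ _∷_ (f v (here refl)) (map-agree vs (λ u u∈vs → f u (there u∈vs)))

  map-updates-unique : ∀ {n} (s : Assign A) (as : Vec A n) (ws : Vec Var n)
                     → Unique ws → map (s [ as // ws ]) ws ≡ as
  map-updates-unique s [] [] [] = refl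
  map-updates-unique s (a ∷ as) (w ∷ ws) (w≢ws ∷ ws-unique) =
    cong₂ _∷_ (update-≡ (s [ as // ws ]) a refl) tail-agrees
    where
      w∉ws : w ∉ ws
      w∉ws w∈ws = All.lookup w≢ws w∈ws refl
      tail-agrees : map ((s [ as // ws ]) [ a / w ]) ws ≡ as
      tail-agrees = trans (map-agree ws (λ u u∈ws → update-≢ (s [ as // ws ]) a λ { refl → w∉ws u∈ws }))
                          (map-updates-unique s as ws ws-unique)

  updates-map-self : ∀ {n} (s s₀ : Assign A) (xs : Vec Var n) {v}
                   → v ∈ xs → (s [ map s₀ xs // xs ]) v ≡ s₀ v
  updates-map-self s s₀ (x ∷ xs) {v} v∈ with v ≟ x
  ... | yes refl = refl
  updates-map-self s s₀ (x ∷ xs) (here v≡x) | no v≢x = ⊥-elim (v≢x v≡x)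
  updates-map-self s s₀ (x ∷ xs) (there v∈xs) | no _ = updates-map-self s s₀ xs v∈xs

module _ {Σ' : Vocabulary} (M : Model Σ') where

  mutual
    evalT-local : (t : Term Σ') {s s' : Assign (Carrier M)}
                → (∀ v → OccT v t → s v ≡ s' v) → evalT M s t ≡ evalT M s' t
    evalT-local (var x) f = f x refl
    evalT-local (app g ts) f = cong (funI M g) (evalTs-local ts f)

    evalTs-local : ∀ {n} (ts : Vec (Term Σ') n) {s s' : Assign (Carrier M)}
                 → (∀ v → OccTs v ts → s v ≡ s' v) → evalTs M s ts ≡ evalTs M s' ts
    evalTs-local [] f = refl
    evalTs-local (t ∷ ts) f =
      cong₂ _∷_ (evalT-local t (λ v o → f v (inj₁ o))) (evalTs-local ts (λ v o → f v (inj₂ o)))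

  evalT-cong : ∀ {s s'} → s ≗A s' → (t : Term Σ') → evalT M s t ≡ evalT M s' t
  evalT-cong e t = evalT-local t (λ v _ → e v)

  evalTs-cong : ∀ {s s' n} → s ≗A s' → (ts : Vec (Term Σ') n) → evalTs M s ts ≡ evalTs M s' ts
  evalTs-cong e ts = evalTs-local ts (λ v _ → e v)

  evalTs-vars : ∀ {n} (s : Assign (Carrier M)) (vs : Vec Var n) → evalTs M s (map var vs) ≡ map s vs
  evalTs-vars s [] = refl
  evalTs-vars s (v ∷ vs) = cong (s v ∷_) (evalTs-vars s vs)

  satP-local : ∀ {k} (P : Vec (Carrier M) k → Set) (ψ : PosFormula Σ' k) {s s' : Assign (Carrier M)}
             → (∀ v → FreeP v ψ → s v ≡ s' v) → satP M P s ψ → satP M P s' ψ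
  satP-local P (eq t u) f h =
    trans (sym (evalT-local t (λ v o → f v (inj₁ o)))) (trans h (evalT-local u (λ v o → f v (inj₂ o))))
  satP-local P (neq t u) f h q =
    h (trans (evalT-local t (λ v o → f v (inj₁ o))) (trans q (sym (evalT-local u (λ v o → f v (inj₂ o))))))
  satP-local P (rel r ts) f h = subst (relI M r) (evalTs-local ts f) h
  satP-local P (nrel r ts) f h q = h (subst (relI M r) (sym (evalTs-local ts f)) q)
  satP-local P (Ratom ts) f h = subst P (evalTs-local ts f) h
  satP-local P (φ ∧' ψ) f (a , b) =
    satP-local P φ (λ v o → f v (inj₁ o)) a , satP-local P ψ (λ v o → f v (inj₂ o)) b
  satP-local P (φ ∨' ψ) f (inj₁ a) = inj₁ (satP-local P φ (λ v o → f v (inj₁ o)) a)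
  satP-local P (φ ∨' ψ) f (inj₂ b) = inj₂ (satP-local P ψ (λ v o → f v (inj₂ o)) b)
  satP-local P (∃' u φ) {s} {s'} f (m , h) =
    m , satP-local P φ (λ v o → update-agree s s' m u v (λ v≢u → f v (v≢u , o))) h
  satP-local P (∀' u φ) {s} {s'} f h m =
    satP-local P φ (λ v o → update-agree s s' m u v (λ v≢u → f v (v≢u , o))) (h m)

  satP-cong : ∀ {k} (P : Vec (Carrier M) k → Set) (ψ : PosFormula Σ' k) {s s' : Assign (Carrier M)}
            → s ≗A s' → satP M P s ψ → satP M P s' ψ
  satP-cong P ψ e = satP-local P ψ (λ v _ → e v)

-- Teams up to pointwise equality

module _ {A : Set} where

  _≲_ : Team A → Team A → Set
  T ≲ X = ∀ t → T t → ∃ λ x → X x × t ≗A x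

  _≋_ : Team A → Team A → Set
  T ≋ X = T ≲ X × X ≲ T

  _⊆ᵀ_ : Team A → Team A → Set
  Y ⊆ᵀ X = ∀ s → Y s → X s

  Supplement : Team A → Set₁
  Supplement X = (s : Assign A) → X s → A → Set

  -- X[H/v] and X[M/v]: exactly the teams by which Defs interprets ∃' v and ∀' v.
  supplement : (X : Team A) → Supplement X → Var → Team A
  supplement X H v t = ∃ λ s → Σ (X s) λ p → ∃ λ m → H s p m × (t ≗A (s [ m / v ]))

  duplicate : Team A → Var → Team A
  duplicate X v t = ∃ λ s → X s × ∃ λ m → t ≗A (s [ m / v ])

  restrict : Team A → Team A → Team A
  restrict T Y t = T t × ∃ λ y → Y y × t ≗A y

  restrict-≋ : {T X Y : Team A} → T ≋ X → Y ⊆ᵀ X → restrict T Y ≋ Y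
  restrict-≋ {T} {X} {Y} (_ , X≲T) Y⊆X = (λ t → proj₂) , Y≲restrict
    where
      Y≲restrict : Y ≲ restrict T Y
      Y≲restrict y y∈Y with X≲T y (Y⊆X y y∈Y)
      ... | t , t∈T , y≗t = t , (t∈T , y , y∈Y , ≗A-sym y≗t) , y≗t

  duplicate-mono-≲ : {T X : Team A} → T ≲ X → ∀ v → duplicate T v ≲ duplicate X v
  duplicate-mono-≲ T≲X v u (t , t∈T , m , u≗t[m/v]) with T≲X t t∈T
  ... | x , x∈X , t≗x =
    x [ m / v ] , (x , x∈X , m , λ _ → refl) , ≗A-trans u≗t[m/v] (update-cong m v t≗x)

  duplicate-resp-≋ : {T X : Team A} → T ≋ X → ∀ v → duplicate T v ≋ duplicate X v
  duplicate-resp-≋ (T≲X , X≲T) v = duplicate-mono-≲ T≲X v , duplicate-mono-≲ X≲T v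

  transport : {X : Team A} (T : Team A) → Supplement X → Supplement T
  transport {X} T H t _ m = ∃ λ x → Σ (X x) λ x∈X → t ≗A x × H x x∈X m

  supplement-resp-≋ : {T X : Team A} (H : Supplement X) → T ≋ X → ∀ v
                    → supplement T (transport T H) v ≋ supplement X H v
  supplement-resp-≋ H (_ , X≲T) v = to , from
    where
      to : supplement _ (transport _ H) v ≲ supplement _ H v
      to u (t , t∈T , m , (x , x∈X , t≗x , h) , u≗t[m/v]) =
        x [ m / v ] , (x , x∈X , m , h , λ _ → refl) , ≗A-trans u≗t[m/v] (update-cong m v t≗x)
      from : supplement _ H v ≲ supplement _ (transport _ H) v
      from u (x , x∈X , m , h , u≗x[m/v]) with X≲T x x∈X
      ... | t , t∈T , x≗t =
        t [ m / v ] , (t , t∈T , m , (x , x∈X , ≗A-sym x≗t , h) , λ _ → refl) ,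
        ≗A-trans u≗x[m/v] (update-cong m v x≗t)

module _ {Σ' : Vocabulary} (M : Model Σ') where

  -- Teams are arbitrary predicates, not closed under ≗A, so the team a proof
  -- builds is in general only ≋ to the one the semantics asks for.
  ⊨-resp-≋ : (φ : IncFormula Σ') {T X : Team (Carrier M)} → T ≋ X → M ⊨[ X ] φ → M ⊨[ T ] φ
  ⊨-resp-≋ (eq t u) (T≲X , _) h s s∈T with T≲X s s∈T
  ... | x , x∈X , s≗x =
    lift (trans (evalT-cong M s≗x t) (trans (lower (h x x∈X)) (sym (evalT-cong M s≗x u))))
  ⊨-resp-≋ (neq t u) (T≲X , _) h s s∈T with T≲X s s∈T
  ... | x , x∈X , s≗x =
    lift (λ q → lower (h x x∈X) (trans (sym (evalT-cong M s≗x t)) (trans q (evalT-cong M s≗x u))))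
  ⊨-resp-≋ (rel r ts) (T≲X , _) h s s∈T with T≲X s s∈T
  ... | x , x∈X , s≗x = lift (subst (relI M r) (sym (evalTs-cong M s≗x ts)) (lower (h x x∈X)))
  ⊨-resp-≋ (nrel r ts) (T≲X , _) h s s∈T with T≲X s s∈T
  ... | x , x∈X , s≗x = lift (λ q → lower (h x x∈X) (subst (relI M r) (evalTs-cong M s≗x ts) q))
  ⊨-resp-≋ (inc ts us) (T≲X , X≲T) h s s∈T with T≲X s s∈T
  ... | x , x∈X , s≗x with lower (h x x∈X)
  ... | x' , x'∈X , ts≡us with X≲T x' x'∈X
  ... | t' , t'∈T , x'≗t' =
    lift (t' , t'∈T , trans (evalTs-cong M s≗x ts) (trans ts≡us (evalTs-cong M x'≗t' us)))
  ⊨-resp-≋ (φ ∧' ψ) T≋X (hφ , hψ) = ⊨-resp-≋ φ T≋X hφ , ⊨-resp-≋ ψ T≋X hψ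
  ⊨-resp-≋ (φ ∨' ψ) {T} T≋X@(T≲X , _) (Y , Z , (X⊆Y∪Z , Y⊆X , Z⊆X) , hY , hZ) =
    restrict T Y , restrict T Z , (cover , (λ _ → proj₁) , (λ _ → proj₁)) ,
    ⊨-resp-≋ φ (restrict-≋ T≋X Y⊆X) hY , ⊨-resp-≋ ψ (restrict-≋ T≋X Z⊆X) hZ
    where
      cover : ∀ t → T t → restrict T Y t ⊎ restrict T Z t
      cover t t∈T with T≲X t t∈T
      ... | x , x∈X , t≗x =
        Sum.map (λ x∈Y → t∈T , x , x∈Y , t≗x) (λ x∈Z → t∈T , x , x∈Z , t≗x) (X⊆Y∪Z x x∈X)
  ⊨-resp-≋ (∃' v φ) {T} T≋X@(T≲X , _) (H , H-nonempty , h) =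
    transport T H , nonempty , ⊨-resp-≋ φ (supplement-resp-≋ H T≋X v) h
    where
      nonempty : ∀ t t∈T → ∃ (transport T H t t∈T)
      nonempty t t∈T with T≲X t t∈T
      ... | x , x∈X , t≗x with H-nonempty x x∈X
      ... | m , hm = m , x , x∈X , t≗x , hm
  ⊨-resp-≋ (∀' v φ) T≋X h = ⊨-resp-≋ φ (duplicate-resp-≋ T≋X v) h

-- Fresh variables

OccP : ∀ {Σ' k} → Var → PosFormula Σ' k → Set
OccP v (eq t u) = OccT v t ⊎ OccT v u
OccP v (neq t u) = OccT v t ⊎ OccT v u
OccP v (rel r ts) = OccTs v ts
OccP v (nrel r ts) = OccTs v ts
OccP v (Ratom ts) = OccTs v ts
OccP v (φ ∧' ψ) = OccP v φ ⊎ OccP v ψ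
OccP v (φ ∨' ψ) = OccP v φ ⊎ OccP v ψ
OccP v (∃' u φ) = v ≡ u ⊎ OccP v φ
OccP v (∀' u φ) = v ≡ u ⊎ OccP v φ

FreeP⇒OccP : ∀ {Σ' k v} (ψ : PosFormula Σ' k) → FreeP v ψ → OccP v ψ
FreeP⇒OccP (eq t u) fr = fr
FreeP⇒OccP (neq t u) fr = fr
FreeP⇒OccP (rel r ts) fr = fr
FreeP⇒OccP (nrel r ts) fr = fr
FreeP⇒OccP (Ratom ts) fr = fr
FreeP⇒OccP (φ ∧' ψ) fr = Sum.map (FreeP⇒OccP φ) (FreeP⇒OccP ψ) fr
FreeP⇒OccP (φ ∨' ψ) fr = Sum.map (FreeP⇒OccP φ) (FreeP⇒OccP ψ) fr
FreeP⇒OccP (∃' u φ) (_ , fr) = inj₂ (FreeP⇒OccP φ fr)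
FreeP⇒OccP (∀' u φ) (_ , fr) = inj₂ (FreeP⇒OccP φ fr)

Avoids : ∀ {Σ' k n} → Vec Var n → PosFormula Σ' k → Set
Avoids ws ψ = ∀ v → OccP v ψ → v ∉ ws

mutual
  termBound : ∀ {Σ'} → Term Σ' → ℕ
  termBound (var x) = suc x
  termBound (app f ts) = termsBound ts

  termsBound : ∀ {Σ' n} → Vec (Term Σ') n → ℕ
  termsBound [] = 0
  termsBound (t ∷ ts) = termBound t ⊔ termsBound ts

mutual
  OccT-bound : ∀ {Σ' v} (t : Term Σ') → OccT v t → v < termBound t
  OccT-bound (var x) v≡x = s≤s (≤-reflexive v≡x)
  OccT-bound (app f ts) o = OccTs-bound ts o

  OccTs-bound : ∀ {Σ' n v} (ts : Vec (Term Σ') n) → OccTs v ts → v < termsBound ts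
  OccTs-bound (t ∷ ts) (inj₁ o) = <-≤-trans (OccT-bound t o) (m≤m⊔n _ _)
  OccTs-bound (t ∷ ts) (inj₂ o) = <-≤-trans (OccTs-bound ts o) (m≤n⊔m _ _)

varBound : ∀ {Σ' k} → PosFormula Σ' k → ℕ
varBound (eq t u) = termBound t ⊔ termBound u
varBound (neq t u) = termBound t ⊔ termBound u
varBound (rel r ts) = termsBound ts
varBound (nrel r ts) = termsBound ts
varBound (Ratom ts) = termsBound ts
varBound (φ ∧' ψ) = varBound φ ⊔ varBound ψ
varBound (φ ∨' ψ) = varBound φ ⊔ varBound ψ
varBound (∃' u φ) = suc u ⊔ varBound φ
varBound (∀' u φ) = suc u ⊔ varBound φ

⊔-bound : ∀ {v m n} → v < m ⊎ v < n → v < m ⊔ n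
⊔-bound {m = m} {n} = [ (λ v<m → <-≤-trans v<m (m≤m⊔n m n)) , (λ v<n → <-≤-trans v<n (m≤n⊔m m n)) ]′

OccP-bound : ∀ {Σ' k v} (ψ : PosFormula Σ' k) → OccP v ψ → v < varBound ψ
OccP-bound (eq t u) o = ⊔-bound (Sum.map (OccT-bound t) (OccT-bound u) o)
OccP-bound (neq t u) o = ⊔-bound (Sum.map (OccT-bound t) (OccT-bound u) o)
OccP-bound (rel r ts) o = OccTs-bound ts o
OccP-bound (nrel r ts) o = OccTs-bound ts o
OccP-bound (Ratom ts) o = OccTs-bound ts o
OccP-bound (φ ∧' ψ) o = ⊔-bound (Sum.map (OccP-bound φ) (OccP-bound ψ) o)
OccP-bound (φ ∨' ψ) o = ⊔-bound (Sum.map (OccP-bound φ) (OccP-bound ψ) o)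
OccP-bound (∃' u φ) o = ⊔-bound (Sum.map (λ v≡u → s≤s (≤-reflexive v≡u)) (OccP-bound φ) o)
OccP-bound (∀' u φ) o = ⊔-bound (Sum.map (λ v≡u → s≤s (≤-reflexive v≡u)) (OccP-bound φ) o)

vecBound : ∀ {n} → Vec Var n → ℕ
vecBound [] = 0
vecBound (x ∷ xs) = suc x ⊔ vecBound xs

∈-vecBound : ∀ {n v} (xs : Vec Var n) → v ∈ xs → v < vecBound xs
∈-vecBound (x ∷ xs) (here v≡x) = ⊔-bound {n = vecBound xs} (inj₁ (s≤s (≤-reflexive v≡x)))
∈-vecBound (x ∷ xs) (there v∈xs) = ⊔-bound (inj₂ (∈-vecBound xs v∈xs))

varsFrom : ℕ → (k : ℕ) → Vec Var k
varsFrom N zero = []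
varsFrom N (suc k) = N ∷ varsFrom (suc N) k

varsFrom-≥ : ∀ N k → All (N ≤_) (varsFrom N k)
varsFrom-≥ N zero = []
varsFrom-≥ N (suc k) = ≤-refl ∷ All.map <⇒≤ (varsFrom-≥ (suc N) k)

varsFrom-unique : ∀ N k → Unique (varsFrom N k)
varsFrom-unique N zero = []
varsFrom-unique N (suc k) = All.map <⇒≢ (varsFrom-≥ (suc N) k) ∷ varsFrom-unique (suc N) k

<⇒∉varsFrom : ∀ {N v} k → v < N → v ∉ varsFrom N k
<⇒∉varsFrom {N} k v<N v∈ = <⇒≱ v<N (All.lookup (varsFrom-≥ N k) v∈)

-- Quantifier blocks and the translation

-- The head of ws is bound innermost, so that the team reached under ∃ⁿ ws
-- consists of the s [ as // ws ], in which the head is also updated last.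
∃ⁿ : ∀ {Σ' n} → Vec Var n → IncFormula Σ' → IncFormula Σ'
∃ⁿ [] ψ = ψ
∃ⁿ (w ∷ ws) ψ = ∃ⁿ ws (∃' w ψ)

FreeI-∃ⁿ : ∀ {Σ' n} (ws : Vec Var n) (ψ : IncFormula Σ') {v}
         → FreeI v (∃ⁿ ws ψ) → FreeI v ψ × v ∉ ws
FreeI-∃ⁿ [] ψ fr = fr , λ ()
FreeI-∃ⁿ (w ∷ ws) ψ fr with FreeI-∃ⁿ ws (∃' w ψ) fr
... | (v≢w , frψ) , v∉ws = frψ , λ { (here v≡w) → v≢w v≡w ; (there v∈ws) → v∉ws v∈ws }

module _ {Σ' : Vocabulary} (M : Model Σ') where

  Choice : ℕ → Team (Carrier M) → Set₁
  Choice n X = (s : Assign (Carrier M)) → X s → Vec (Carrier M) n → Set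

  extensions : ∀ {n} (X : Team (Carrier M)) → Choice n X → Vec Var n → Team (Carrier M)
  extensions X G ws t = ∃ λ s → Σ (X s) λ p → ∃ λ as → G s p as × t ≗A (s [ as // ws ])

  ∃ⁿ-intro : ∀ {n} (ws : Vec Var n) (ψ : IncFormula Σ') (X : Team (Carrier M)) (G : Choice n X)
           → (∀ s p → ∃ (G s p)) → M ⊨[ extensions X G ws ] ψ → M ⊨[ X ] ∃ⁿ ws ψ
  ∃ⁿ-intro [] ψ X G G-nonempty h = ⊨-resp-≋ M ψ (X≲ , ≲X) h
    where
      X≲ : X ≲ extensions X G []
      X≲ s s∈X with G-nonempty s s∈X
      ... | [] , g = s , (s , s∈X , [] , g , λ _ → refl) , λ _ → refl
      ≲X : extensions X G [] ≲ X
      ≲X t (s , s∈X , [] , _ , t≗s) = s , s∈X , t≗s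
  ∃ⁿ-intro (w ∷ ws) ψ X G G-nonempty h =
    ∃ⁿ-intro ws (∃' w ψ) X G′ G′-nonempty (H , H-nonempty , ⊨-resp-≋ M ψ (to , from) h)
    where
      G′ : Choice _ X
      G′ s p as = ∃ λ m → G s p (m ∷ as)
      G′-nonempty : ∀ s p → ∃ (G′ s p)
      G′-nonempty s p with G-nonempty s p
      ... | m ∷ as , g = as , m , g
      H : Supplement (extensions X G′ ws)
      H t (s , p , as , _ , _) m = G s p (m ∷ as)
      H-nonempty : ∀ t q → ∃ (H t q)
      H-nonempty t (s , p , as , (m , g) , _) = m , g
      to : supplement (extensions X G′ ws) H w ≲ extensions X G (w ∷ ws)
      to u (t , (s , p , as , _ , t≗) , m , g , u≗t[m/w]) =
        u , (s , p , m ∷ as , g , ≗A-trans u≗t[m/w] (update-cong m w t≗)) , λ _ → refl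
      from : extensions X G (w ∷ ws) ≲ supplement (extensions X G′ ws) H w
      from u (s , p , m ∷ as , g , u≗) =
        u , (s [ as // ws ] , (s , p , as , (m , g) , λ _ → refl) , m , g , u≗) , λ _ → refl

  ∃ⁿ-elim : ∀ {n} (ws : Vec Var n) (ψ : IncFormula Σ') (X : Team (Carrier M)) → M ⊨[ X ] ∃ⁿ ws ψ
          → Σ (Team (Carrier M)) λ T → M ⊨[ T ] ψ
              × (∀ s → X s → ∃ λ t → T t × ∃ λ as → t ≗A (s [ as // ws ]))
              × (∀ t → T t → ∃ λ s → X s × ∃ λ as → t ≗A (s [ as // ws ]))
  ∃ⁿ-elim [] ψ X h =
    X , h , (λ s s∈X → s , s∈X , [] , λ _ → refl) , (λ t t∈X → t , t∈X , [] , λ _ → refl)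
  ∃ⁿ-elim (w ∷ ws) ψ X h with ∃ⁿ-elim ws (∃' w ψ) X h
  ... | T , (H , H-nonempty , hψ) , forth , back = supplement T H w , hψ , forth′ , back′
    where
      forth′ : ∀ s → X s → ∃ λ u → supplement T H w u × ∃ λ as → u ≗A (s [ as // w ∷ ws ])
      forth′ s s∈X with forth s s∈X
      ... | t , t∈T , as , t≗ with H-nonempty t t∈T
      ... | m , hm = t [ m / w ] , (t , t∈T , m , hm , λ _ → refl) , m ∷ as , update-cong m w t≗
      back′ : ∀ u → supplement T H w u → ∃ λ s → X s × ∃ λ as → u ≗A (s [ as // w ∷ ws ])
      back′ u (t , t∈T , m , hm , u≗t[m/w]) with back t t∈T
      ... | s , s∈X , as , t≗ = s , s∈X , m ∷ as , ≗A-trans u≗t[m/w] (update-cong m w t≗)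

toInclusion : ∀ {Σ' k} → Vec Var k → PosFormula Σ' k → IncFormula Σ'
toInclusion ws (eq t u) = eq t u
toInclusion ws (neq t u) = neq t u
toInclusion ws (rel r ts) = rel r ts
toInclusion ws (nrel r ts) = nrel r ts
toInclusion ws (Ratom ts) = inc ts (map var ws)
toInclusion ws (φ ∧' ψ) = toInclusion ws φ ∧' toInclusion ws ψ
toInclusion ws (φ ∨' ψ) = toInclusion ws φ ∨' toInclusion ws ψ
toInclusion ws (∃' v φ) = ∃' v (toInclusion ws φ)
toInclusion ws (∀' v φ) = ∀' v (toInclusion ws φ)

OccTs-vars : ∀ {Σ' n v} (vs : Vec Var n) → OccTs {Σ'} v (map var vs) → v ∈ vs
OccTs-vars (x ∷ xs) (inj₁ v≡x) = here v≡x
OccTs-vars (x ∷ xs) (inj₂ o) = there (OccTs-vars xs o)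

FreeI-toInclusion : ∀ {Σ' k v} (ws : Vec Var k) (ψ : PosFormula Σ' k)
                  → FreeI v (toInclusion ws ψ) → FreeP v ψ ⊎ v ∈ ws
FreeI-toInclusion ws (eq t u) fr = inj₁ fr
FreeI-toInclusion ws (neq t u) fr = inj₁ fr
FreeI-toInclusion ws (rel r ts) fr = inj₁ fr
FreeI-toInclusion ws (nrel r ts) fr = inj₁ fr
FreeI-toInclusion ws (Ratom ts) (inj₁ o) = inj₁ o
FreeI-toInclusion ws (Ratom ts) (inj₂ o) = inj₂ (OccTs-vars ws o)
FreeI-toInclusion ws (φ ∧' ψ) (inj₁ fr) = Sum.map₁ inj₁ (FreeI-toInclusion ws φ fr)
FreeI-toInclusion ws (φ ∧' ψ) (inj₂ fr) = Sum.map₁ inj₂ (FreeI-toInclusion ws ψ fr)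
FreeI-toInclusion ws (φ ∨' ψ) (inj₁ fr) = Sum.map₁ inj₁ (FreeI-toInclusion ws φ fr)
FreeI-toInclusion ws (φ ∨' ψ) (inj₂ fr) = Sum.map₁ inj₂ (FreeI-toInclusion ws ψ fr)
FreeI-toInclusion ws (∃' u φ) (v≢u , fr) = Sum.map₁ (v≢u ,_) (FreeI-toInclusion ws φ fr)
FreeI-toInclusion ws (∀' u φ) (v≢u , fr) = Sum.map₁ (v≢u ,_) (FreeI-toInclusion ws φ fr)

module Translation {Σ' : Vocabulary} (M : Model Σ') {k : ℕ}
                   (Q : Vec (Carrier M) k → Set) (ws : Vec Var k) where

  ResetClosed : Team (Carrier M) → Set
  ResetClosed T = ∀ t bs → T t → Q bs → T (t [ bs // ws ])

  reset-update : ∀ {u s : Assign (Carrier M)} {m v} bs → v ∉ ws → u ≗A (s [ m / v ])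
               → (u [ bs // ws ]) ≗A ((s [ bs // ws ]) [ m / v ])
  reset-update {s = s} {m} bs v∉ws u≗ = ≗A-trans (updates-cong bs ws u≗) (updates-comm s m bs ws v∉ws)

  update-keeps-Q : ∀ {u s : Assign (Carrier M)} {m v} → v ∉ ws → u ≗A (s [ m / v ])
                 → Q (map s ws) → Q (map u ws)
  update-keeps-Q {s = s} {m} v∉ws u≗ = subst Q (sym (trans (map-cong u≗ ws)
    (map-agree ws (λ w w∈ws → update-≢ s m λ { refl → v∉ws w∈ws }))))

  satP-reset : (ψ : PosFormula Σ' k) → Avoids ws ψ
             → ∀ t bs → satP M Q t ψ → satP M Q (t [ bs // ws ]) ψ
  satP-reset ψ avoid t bs =
    satP-local M Q ψ (λ v fr → sym (updates-∉ t bs ws (avoid v (FreeP⇒OccP ψ fr))))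

  toInclusion-sound : (ψ : PosFormula Σ' k) → Avoids ws ψ → (T : Team (Carrier M))
                    → (∀ t → T t → Q (map t ws)) → M ⊨[ T ] toInclusion ws ψ
                    → ∀ t → T t → satP M Q t ψ
  toInclusion-sound (eq t u) _ T _ h s s∈T = lower (h s s∈T)
  toInclusion-sound (neq t u) _ T _ h s s∈T = lower (h s s∈T)
  toInclusion-sound (rel r ts) _ T _ h s s∈T = lower (h s s∈T)
  toInclusion-sound (nrel r ts) _ T _ h s s∈T = lower (h s s∈T)
  toInclusion-sound (Ratom ts) _ T Q-ws h s s∈T with lower (h s s∈T)
  ... | t , t∈T , ts≡ws = subst Q (sym (trans ts≡ws (evalTs-vars M t ws))) (Q-ws t t∈T)
  toInclusion-sound (φ ∧' ψ) avoid T Q-ws (hφ , hψ) s s∈T =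
    toInclusion-sound φ (λ v o → avoid v (inj₁ o)) T Q-ws hφ s s∈T ,
    toInclusion-sound ψ (λ v o → avoid v (inj₂ o)) T Q-ws hψ s s∈T
  toInclusion-sound (φ ∨' ψ) avoid T Q-ws (Y , Z , (T⊆Y∪Z , Y⊆T , Z⊆T) , hY , hZ) s s∈T =
    Sum.map (toInclusion-sound φ (λ v o → avoid v (inj₁ o)) Y (λ t t∈Y → Q-ws t (Y⊆T t t∈Y)) hY s)
            (toInclusion-sound ψ (λ v o → avoid v (inj₂ o)) Z (λ t t∈Z → Q-ws t (Z⊆T t t∈Z)) hZ s)
            (T⊆Y∪Z s s∈T)
  toInclusion-sound (∃' v φ) avoid T Q-ws (H , H-nonempty , h) s s∈T with H-nonempty s s∈T
  ... | m , hm = m , toInclusion-sound φ (λ u o → avoid u (inj₂ o)) (supplement T H v) Q-ws′ h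
                       (s [ m / v ]) (s , s∈T , m , hm , λ _ → refl)
    where
      Q-ws′ : ∀ u → supplement T H v u → Q (map u ws)
      Q-ws′ u (s₀ , s₀∈T , _ , _ , u≗) = update-keeps-Q (avoid v (inj₁ refl)) u≗ (Q-ws s₀ s₀∈T)
  toInclusion-sound (∀' v φ) avoid T Q-ws h s s∈T m =
    toInclusion-sound φ (λ u o → avoid u (inj₂ o)) (duplicate T v) Q-ws′ h
      (s [ m / v ]) (s , s∈T , m , λ _ → refl)
    where
      Q-ws′ : ∀ u → duplicate T v u → Q (map u ws)
      Q-ws′ u (s₀ , s₀∈T , _ , u≗) = update-keeps-Q (avoid v (inj₁ refl)) u≗ (Q-ws s₀ s₀∈T)

  satisfying : PosFormula Σ' k → Team (Carrier M) → Team (Carrier M)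
  satisfying χ T t = T t × satP M Q t χ

  witnesses : Var → PosFormula Σ' k → (T : Team (Carrier M)) → Supplement T
  witnesses v χ T s _ m = satP M Q (s [ m / v ]) χ

  satisfying-resetClosed : ∀ {T} χ → Avoids ws χ → ResetClosed T → ResetClosed (satisfying χ T)
  satisfying-resetClosed χ avoid reset t bs (t∈T , hχ) q = reset t bs t∈T q , satP-reset χ avoid t bs hχ

  duplicate-resetClosed : ∀ {T} v → v ∉ ws → ResetClosed T → ResetClosed (duplicate T v)
  duplicate-resetClosed v v∉ws reset u bs (s , s∈T , m , u≗) q =
    s [ bs // ws ] , reset s bs s∈T q , m , reset-update bs v∉ws u≗

  supplement-resetClosed : ∀ {T} v χ → v ∉ ws → Avoids ws χ → ResetClosed T
                         → ResetClosed (supplement T (witnesses v χ T) v)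
  supplement-resetClosed v χ v∉ws avoid reset u bs (s , s∈T , m , hm , u≗) q =
    s [ bs // ws ] , reset s bs s∈T q , m ,
    satP-cong M Q χ (reset-update bs v∉ws (λ _ → refl)) (satP-reset χ avoid (s [ m / v ]) bs hm) ,
    reset-update bs v∉ws u≗

  toInclusion-complete : Unique ws → (ψ : PosFormula Σ' k) → Avoids ws ψ → (T : Team (Carrier M))
                       → (∀ t → T t → satP M Q t ψ) → ResetClosed T
                       → M ⊨[ T ] toInclusion ws ψ
  toInclusion-complete _ (eq t u) _ T sat _ s s∈T = lift (sat s s∈T)
  toInclusion-complete _ (neq t u) _ T sat _ s s∈T = lift (sat s s∈T)
  toInclusion-complete _ (rel r ts) _ T sat _ s s∈T = lift (sat s s∈T)
  toInclusion-complete _ (nrel r ts) _ T sat _ s s∈T = lift (sat s s∈T)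
  toInclusion-complete unique (Ratom ts) _ T sat reset s s∈T =
    lift (s [ bs // ws ] , reset s bs s∈T (sat s s∈T) ,
          sym (trans (evalTs-vars M (s [ bs // ws ]) ws) (map-updates-unique s bs ws unique)))
    where bs = evalTs M s ts
  toInclusion-complete unique (φ ∧' ψ) avoid T sat reset =
    toInclusion-complete unique φ (λ v o → avoid v (inj₁ o)) T (λ t t∈T → proj₁ (sat t t∈T)) reset ,
    toInclusion-complete unique ψ (λ v o → avoid v (inj₂ o)) T (λ t t∈T → proj₂ (sat t t∈T)) reset
  toInclusion-complete unique (φ ∨' ψ) avoid T sat reset =
    satisfying φ T , satisfying ψ T ,
    ((λ t t∈T → Sum.map (t∈T ,_) (t∈T ,_) (sat t t∈T)) , (λ _ → proj₁) , (λ _ → proj₁)) ,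
    toInclusion-complete unique φ avoidφ _ (λ _ → proj₂) (satisfying-resetClosed φ avoidφ reset) ,
    toInclusion-complete unique ψ avoidψ _ (λ _ → proj₂) (satisfying-resetClosed ψ avoidψ reset)
    where
      avoidφ : Avoids ws φ
      avoidφ v o = avoid v (inj₁ o)
      avoidψ : Avoids ws ψ
      avoidψ v o = avoid v (inj₂ o)
  toInclusion-complete unique (∃' v φ) avoid T sat reset =
    witnesses v φ T , sat ,
    toInclusion-complete unique φ avoidφ _
      (λ { u (_ , _ , _ , hm , u≗) → satP-cong M Q φ (≗A-sym u≗) hm })
      (supplement-resetClosed v φ (avoid v (inj₁ refl)) avoidφ reset)
    where
      avoidφ : Avoids ws φ
      avoidφ u o = avoid u (inj₂ o)
  toInclusion-complete unique (∀' v φ) avoid T sat reset =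
    toInclusion-complete unique φ (λ u o → avoid u (inj₂ o)) (duplicate T v)
      (λ { u (s , s∈T , m , u≗) → satP-cong M Q φ (≗A-sym u≗) (sat s s∈T m) })
      (duplicate-resetClosed v (avoid v (inj₁ refl)) reset)

module MyopicTranslation {Σ' : Vocabulary} {k : ℕ} (φ : Myopic Σ' k) (ws : Vec Var k)
                         (ws-unique : Unique ws) (ws-avoid-θ : Avoids ws (θ φ))
                         (ws-avoid-xs : ∀ v → v ∈ xs φ → v ∉ ws) where

  φ⁺ : IncFormula Σ'
  φ⁺ = ∃ⁿ ws (inc (map var ws) (map var (xs φ)) ∧' toInclusion ws (θ φ))

  φ⁺-free : ∀ v → FreeI v φ⁺ → v ∈ xs φ
  φ⁺-free v fr with FreeI-∃ⁿ ws _ fr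
  ... | inj₁ (inj₁ o) , v∉ws = ⊥-elim (v∉ws (OccTs-vars ws o))
  ... | inj₁ (inj₂ o) , _ = OccTs-vars (xs φ) o
  ... | inj₂ frθ , v∉ws =
    [ closed φ v , (λ v∈ws → ⊥-elim (v∉ws v∈ws)) ]′ (FreeI-toInclusion ws (θ φ) frθ)

  module _ (M : Model Σ') (X : Team (Carrier M)) where
    open Translation M (teamRel X (xs φ)) ws
    open ≡-Reasoning

    updates-keep-xs : ∀ (s : Assign (Carrier M)) bs → map (s [ bs // ws ]) (xs φ) ≡ map s (xs φ)
    updates-keep-xs s bs = map-agree (xs φ) (λ v v∈xs → updates-∉ s bs ws (ws-avoid-xs v v∈xs))

    updates-agree-on-θ : ∀ (s : Assign (Carrier M)) bs v → FreeP v (θ φ) → (s [ bs // ws ]) v ≡ s v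
    updates-agree-on-θ s bs v fr = updates-∉ s bs ws (ws-avoid-θ v (FreeP⇒OccP (θ φ) fr))

    sound : M ⊨[ X ] φ⁺ → M , teamRel X (xs φ) ⊨M φ
    sound h s as (s₀ , s₀∈X , s₀-xs≡as) with ∃ⁿ-elim M ws _ X h
    ... | T , (h-inc , hθ) , forth , back with forth s₀ s₀∈X
    ... | t , t∈T , bs , t≗ =
      satP-local M _ (θ φ) agree (toInclusion-sound (θ φ) ws-avoid-θ T ws-in-Xxs hθ t t∈T)
      where
        ws-in-Xxs : ∀ u → T u → teamRel X (xs φ) (map u ws)
        ws-in-Xxs u u∈T with lower (h-inc u u∈T)
        ... | u′ , u′∈T , ws≡xs with back u′ u′∈T
        ... | s₁ , s₁∈X , bs₁ , u′≗ = s₁ , s₁∈X , (begin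
          map s₁ (xs φ)                        ≡⟨ updates-keep-xs s₁ bs₁ ⟨
          map (s₁ [ bs₁ // ws ]) (xs φ)        ≡⟨ map-cong u′≗ (xs φ) ⟨
          map u′ (xs φ)                        ≡⟨ evalTs-vars M u′ (xs φ) ⟨
          evalTs M u′ (map var (xs φ))         ≡⟨ ws≡xs ⟨
          evalTs M u (map var ws)              ≡⟨ evalTs-vars M u ws ⟩
          map u ws                             ∎)
        agree : ∀ v → FreeP v (θ φ) → t v ≡ (s [ as // xs φ ]) v
        agree v fr = begin
          t v                                  ≡⟨ t≗ v ⟩
          (s₀ [ bs // ws ]) v                  ≡⟨ updates-agree-on-θ s₀ bs v fr ⟩
          s₀ v                                 ≡⟨ updates-map-self s s₀ (xs φ) (closed φ v fr) ⟨
          (s [ map s₀ (xs φ) // xs φ ]) v      ≡⟨ cong (λ cs → (s [ cs // xs φ ]) v) s₀-xs≡as ⟩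
          (s [ as // xs φ ]) v                 ∎

    complete : M , teamRel X (xs φ) ⊨M φ → M ⊨[ X ] φ⁺
    complete sat = ∃ⁿ-intro M ws _ X G (λ s s∈X → map s (xs φ) , s , s∈X , refl)
      (ws⊆xs , toInclusion-complete ws-unique (θ φ) ws-avoid-θ T satθ reset)
      where
        G : Choice M k X
        G _ _ = teamRel X (xs φ)
        T : Team (Carrier M)
        T = extensions M X G ws
        ws⊆xs : M ⊨[ T ] inc (map var ws) (map var (xs φ))
        ws⊆xs t (s , s∈X , as , q@(s₁ , s₁∈X , s₁-xs≡as) , t≗) =
          lift (s₁ [ as // ws ] , (s₁ , s₁∈X , as , q , λ _ → refl) , (begin
            evalTs M t (map var ws)              ≡⟨ evalTs-vars M t ws ⟩
            map t ws                             ≡⟨ map-cong t≗ ws ⟩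
            map (s [ as // ws ]) ws              ≡⟨ map-updates-unique s as ws ws-unique ⟩
            as                                   ≡⟨ s₁-xs≡as ⟨
            map s₁ (xs φ)                        ≡⟨ updates-keep-xs s₁ as ⟨
            map (s₁ [ as // ws ]) (xs φ)         ≡⟨ evalTs-vars M _ (xs φ) ⟨
            evalTs M (s₁ [ as // ws ]) (map var (xs φ)) ∎))
        satθ : ∀ t → T t → satP M (teamRel X (xs φ)) t (θ φ)
        satθ t (s , s∈X , as , _ , t≗) =
          satP-local M _ (θ φ) agree (sat s (map s (xs φ)) (s , s∈X , refl))
          where
            agree : ∀ v → FreeP v (θ φ) → (s [ map s (xs φ) // xs φ ]) v ≡ t v
            agree v fr = begin
              (s [ map s (xs φ) // xs φ ]) v     ≡⟨ updates-map-self s s (xs φ) (closed φ v fr) ⟩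
              s v                                ≡⟨ updates-agree-on-θ s as v fr ⟨
              (s [ as // ws ]) v                 ≡⟨ t≗ v ⟨
              t v                                ∎
        reset : ResetClosed T
        reset t bs (s , s∈X , as , _ , t≗) q =
          s , s∈X , bs , q , ≗A-trans (updates-cong bs ws t≗) (updates-overwrite s as bs ws)

proposition20 : (Σ' : Vocabulary) (k : ℕ) (φ : Myopic Σ' k)
    → Σ (IncFormula Σ') λ φ⁺ →
    ((v : Var) → FreeI v φ⁺ → v ∈ xs φ)
    × ((M : Model Σ') (X : Team (Carrier M))
    → (M ⊨[ X ] φ⁺) ⇔ (M , teamRel X (xs φ) ⊨M φ))
proposition20 Σ' k φ = φ⁺ , φ⁺-free , λ M X → mk⇔ (sound M X) (complete M X)
  where
    N : ℕ
    N = varBound (θ φ) ⊔ vecBound (xs φ)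
    open MyopicTranslation φ (varsFrom N k) (varsFrom-unique N k)
      (λ v o → <⇒∉varsFrom k (⊔-bound (inj₁ (OccP-bound (θ φ) o))))
      (λ v v∈xs → <⇒∉varsFrom k (⊔-bound (inj₂ (∈-vecBound (xs φ) v∈xs))))
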